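{- Let $(P_n)_{n\in\mathbb{Z}}$ be the Padovan sequence. For every integer $a$ put $\rho_a=3P_{a-2}-P_{a-4}$ and $\sigma_a=-\rho_{ -a}$. Then for all integers $a,n$ with $a<n$, $$P_n=\rho_aP_{n-a}+\sigma_aP_{n-2a}+P_{n-3a}.$$
   Context: The Padovan numbers are defined by $P_0=P_1=P_2=1$ and $P_{n+3}=P_{n+1}+P_n$ for $n\ge 0$; the sequence is extended to all integers $n$ by the recurrence read backwards, $P_n=P_{n+3}-P_{n+1}$. -}

module Defs where

open import Data.Nat as ℕ using (ℕ; zero; suc)
open import Data.Integer using (ℤ; +_; -[1+_]; _+_; _-_; _*_; -_)
open import Data.Product using (_×_; _,_; proj₁)

Pℕ : ℕ → ℤ
Pℕ 0 = + 1
Pℕ 1 = + 1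
Pℕ 2 = + 1
Pℕ (suc (suc (suc n))) = Pℕ (suc n) + Pℕ n

-- Backward window: back k = (P_{-k}, P_{-k+1}, P_{-k+2}),
-- using the backward recurrence P_m = P_{m+3} - P_{m+1}.
back : ℕ → ℤ × ℤ × ℤ
back zero = (+ 1 , + 1 , + 1)
back (suc k) with back k
... | (a , b , c) = (c - a , a , b)

P : ℤ → ℤ
P (+ n) = Pℕ n
P -[1+ k ] = proj₁ (back (suc k))

ρ : ℤ → ℤ
ρ a = + 3 * P (a - + 2) - P (a - + 4)

σ : ℤ → ℤ
σ a = - ρ (- a)

open import Relation.Binary.PropositionalEquality using (_≡_; refl)
_ : P -[1+ 0 ] ≡ + 0
_ = refl
_ : P -[1+ 1 ] ≡ + 1
_ = refl
_ : P -[1+ 2 ] ≡ + 0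
_ = refl
_ : P -[1+ 3 ] ≡ + 0
_ = refl
_ : P -[1+ 4 ] ≡ + 1
_ = refl

module Submission where

-- Let ψ be a root of X³ − X − 1, and write ψ^ t = P (t − 5) + P (t − 3) ψ + P (t − 4) ψ²,
-- so that P n is the ψ-coordinate of ψ^ (n + 3). By Cayley–Hamilton, y = ψ^ a satisfies
-- y³ = tr(y) y² − e₂(y) y + N(y). Here tr(y) = ρ a; N(y) = 1 because ψ is a unit of norm 1;
-- and e₂(y) = tr(adj y) with adj y = N(y) y⁻¹ = ψ^ (− a), so e₂(y) = ρ (− a) = − σ a.
-- Multiplying by ψ^ (n − 3a + 3) and reading off the ψ-coordinate gives the identity.

open import Algebra.Bundles.Raw using (RawRing)

-- Arithmetic in R[ψ] = R[X]/(X³ − X − 1), over an arbitrary raw ring so that it can be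
-- instantiated both at ℤ and at ring-solver expressions: every polynomial identity in
-- ℤ[ψ] below is then proved by normalising the coordinates of its two sides.
module ψ-Arithmetic {c ℓ} (R : RawRing c ℓ) where
  open RawRing R

  infixl 6 _-_
  infixl 7 _·_
  infix 8 _² _³

  record R[ψ] : Set c where
    constructor ⟨_,_,_⟩
    field
      c₀ c₁ c₂ : Carrier

  open R[ψ] public

  _-_ : Carrier → Carrier → Carrier
  x - y = x + - y

  -- h and k are the coefficients of ψ³ = ψ + 1 and ψ⁴ = ψ² + ψ in the expanded product.
  _·_ : R[ψ] → R[ψ] → R[ψ]
  ⟨ p , q , r ⟩ · ⟨ a , b , c ⟩ =
    let h = q * c + r * b ; k = r * c in
    ⟨ p * a + h , p * b + q * a + h + k , p * c + q * b + r * a + k ⟩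

  _² _³ : R[ψ] → R[ψ]
  y ² = y · y
  y ³ = y · y ²

  𝟙 ψ ψ⁻¹ : R[ψ]
  𝟙 = ⟨ 1# , 0# , 0# ⟩
  ψ = ⟨ 0# , 1# , 0# ⟩
  ψ⁻¹ = ⟨ - 1# , 0# , 1# ⟩

  tr : R[ψ] → Carrier
  tr ⟨ p , _ , r ⟩ = p + p + p + r + r

  -- adj y is the product of the two other conjugates of y, so y · adj y is the norm of y.
  adj : R[ψ] → R[ψ]
  adj ⟨ p , q , r ⟩ =
    ⟨ (p + r) * (p + r) - q * (q + r) , r * (q + r) - q * (p + r) , q * q - r * (p + r) ⟩

  N : R[ψ] → Carrier
  N y = c₀ (y · adj y)

open import Data.Fin using (Fin; combine)
open import Data.Fin.Patterns using (0F; 1F; 2F)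
open import Data.Integer
  using (ℤ; +_; -[1+_]; 0ℤ; 1ℤ; -1ℤ; _+_; _-_; _*_; -_; _<_; pred; +-*-rawRing)
  renaming (suc to sucℤ)
open import Data.Integer.Properties
  using (+-assoc; +-identityʳ; +-inverseʳ; +-pred; suc-pred; neg-distrib-+; neg-distribˡ-*;
         *-identityˡ; +-commutativeSemigroup)
open import Data.Integer.Tactic.RingSolver using (ring; solve-∀)
open import Data.Nat as ℕ using (ℕ)
open import Data.Vec using (Vec; []; _∷_; concat; map)
open import Function using (_∘_)
open import Relation.Binary.PropositionalEquality
  using (_≡_; refl; sym; trans; cong; cong₂; module ≡-Reasoning)
open import Tactic.RingSolver.Core.Expression using (Expr; Κ; Ι; _⊕_; _⊗_; ⊝_)
open import Tactic.RingSolver.NonReflective ring using (module Ops)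

open import Algebra.Properties.CommutativeSemigroup +-commutativeSemigroup using (x∙yz≈y∙xz)
open import Defs

open ψ-Arithmetic +-*-rawRing hiding (_-_) renaming (R[ψ] to ℤ[ψ])
open ≡-Reasoning

⟨⟩-cong : ∀ {a b c a′ b′ c′ : ℤ} → a ≡ a′ → b ≡ b′ → c ≡ c′ → ⟨ a , b , c ⟩ ≡ ⟨ a′ , b′ , c′ ⟩
⟨⟩-cong refl refl refl = refl

private
  Expr-rawRing : ℕ → RawRing _ _
  Expr-rawRing n = record
    { Carrier = Expr ℤ n ; _≈_ = _≡_ ; _+_ = _⊕_ ; _*_ = _⊗_ ; -_ = ⊝_ ; 0# = Κ 0ℤ ; 1# = Κ 1ℤ }

  module S {n : ℕ} = ψ-Arithmetic (Expr-rawRing n)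

  var : ∀ {m} → Fin m → S.R[ψ] {m ℕ.* 3}
  var i = S.⟨ Ι (combine i 0F) , Ι (combine i 1F) , Ι (combine i 2F) ⟩

  coordinates : ∀ {m} → Vec ℤ[ψ] m → Vec ℤ (m ℕ.* 3)
  coordinates xs = concat (map (λ x → c₀ x ∷ c₁ x ∷ c₂ x ∷ []) xs)

  ⟦_⟧ : ∀ {m} → S.R[ψ] {m ℕ.* 3} → Vec ℤ[ψ] m → ℤ[ψ]
  ⟦ e ⟧ xs = ⟨ Ops.⟦ S.c₀ e ⟧ env , Ops.⟦ S.c₁ e ⟧ env , Ops.⟦ S.c₂ e ⟧ env ⟩
    where env = coordinates xs

  ≡-by-normalisation : ∀ {m} (e e′ : S.R[ψ] {m ℕ.* 3}) (xs : Vec ℤ[ψ] m) →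
    let env = coordinates xs in
    Ops.⟦ S.c₀ e ⇓⟧ env ≡ Ops.⟦ S.c₀ e′ ⇓⟧ env →
    Ops.⟦ S.c₁ e ⇓⟧ env ≡ Ops.⟦ S.c₁ e′ ⇓⟧ env →
    Ops.⟦ S.c₂ e ⇓⟧ env ≡ Ops.⟦ S.c₂ e′ ⇓⟧ env →
    ⟦ e ⟧ xs ≡ ⟦ e′ ⟧ xs
  ≡-by-normalisation e e′ xs eq₀ eq₁ eq₂ = ⟨⟩-cong
    (Ops.prove env (S.c₀ e) (S.c₀ e′) eq₀)
    (Ops.prove env (S.c₁ e) (S.c₁ e′) eq₁)
    (Ops.prove env (S.c₂ e) (S.c₂ e′) eq₂)
    where env = coordinates xs

x·yz≡y·xz : ∀ x y z → x · (y · z) ≡ y · (x · z)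
x·yz≡y·xz x y z =
  ≡-by-normalisation (u S.· (v S.· w)) (v S.· (u S.· w)) (x ∷ y ∷ z ∷ []) refl refl refl
  where u = var {3} 0F ; v = var {3} 1F ; w = var {3} 2F

·-identityʳ : ∀ x → x · 𝟙 ≡ x
·-identityʳ x = ≡-by-normalisation (u S.· S.𝟙) u (x ∷ []) refl refl refl
  where u = var {1} 0F

ψ·-coordinates : ∀ x → ψ · x ≡ ⟨ c₂ x , c₂ x + c₀ x , c₁ x ⟩
ψ·-coordinates x =
  ≡-by-normalisation (S.ψ S.· u) S.⟨ S.c₂ u , S.c₂ u ⊕ S.c₀ u , S.c₁ u ⟩ (x ∷ []) refl refl refl
  where u = var {1} 0F

ψ⁻¹·ψ·x≡x : ∀ x → ψ⁻¹ · (ψ · x) ≡ x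
ψ⁻¹·ψ·x≡x x = ≡-by-normalisation (S.ψ⁻¹ S.· (S.ψ S.· u)) u (x ∷ []) refl refl refl
  where u = var {1} 0F

adj-ψ· : ∀ x → adj (ψ · x) ≡ ψ⁻¹ · adj x
adj-ψ· x = ≡-by-normalisation (S.adj (S.ψ S.· u)) (S.ψ⁻¹ S.· S.adj u) (x ∷ []) refl refl refl
  where u = var {1} 0F

adj-ψ⁻¹· : ∀ x → adj (ψ⁻¹ · x) ≡ ψ · adj x
adj-ψ⁻¹· x = ≡-by-normalisation (S.adj (S.ψ⁻¹ S.· u)) (S.ψ S.· S.adj u) (x ∷ []) refl refl refl
  where u = var {1} 0F

cayley-hamilton : ∀ w y →
  c₁ (w · y ³) ≡ tr y * c₁ (w · y ²) - tr (adj y) * c₁ (w · y) + N y * c₁ w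
cayley-hamilton w y = Ops.prove (coordinates (w ∷ y ∷ []))
  (S.c₁ (u S.· v S.³))
  (S.tr v ⊗ S.c₁ (u S.· v S.²) S.- S.tr (S.adj v) ⊗ S.c₁ (u S.· v) ⊕ S.N v ⊗ S.c₁ u)
  refl
  where u = var {2} 0F ; v = var {2} 1F

ℤ-induction : (Q : ℤ → Set) → Q 0ℤ → (∀ t → Q t → Q (sucℤ t)) → (∀ t → Q t → Q (pred t)) →
              ∀ t → Q t
ℤ-induction Q q₀ q₊ q₋ (+ ℕ.zero)     = q₀
ℤ-induction Q q₀ q₊ q₋ (+ ℕ.suc n)    = q₊ (+ n) (ℤ-induction Q q₀ q₊ q₋ (+ n))
ℤ-induction Q q₀ q₊ q₋ -[1+ ℕ.zero ]  = q₋ 0ℤ q₀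
ℤ-induction Q q₀ q₊ q₋ -[1+ ℕ.suc n ] = q₋ -[1+ n ] (ℤ-induction Q q₀ q₊ q₋ -[1+ n ])

P-rec : ∀ t → P (+ 3 + t) ≡ P (+ 1 + t) + P t
P-rec (+ n)    = refl
P-rec -[1+ 0 ] = refl
P-rec -[1+ 1 ] = refl
P-rec -[1+ 2 ] = refl
P-rec -[1+ ℕ.suc (ℕ.suc (ℕ.suc k)) ] = x≡y+[x-y] (P -[1+ k ]) (P -[1+ ℕ.suc (ℕ.suc k) ])
  where
  x≡y+[x-y] : ∀ x y → x ≡ y + (x - y)
  x≡y+[x-y] = solve-∀

P[t-2]≡P[t-4]+P[t-5] : ∀ t → P (t - + 2) ≡ P (t - + 4) + P (t - + 5)
P[t-2]≡P[t-4]+P[t-5] t = begin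
  P (t - + 2)                        ≡⟨ cong P (shift t (+ 3)) ⟩
  P (+ 3 + (t - + 5))                ≡⟨ P-rec (t - + 5) ⟩
  P (+ 1 + (t - + 5)) + P (t - + 5)  ≡⟨ cong (λ x → P x + P (t - + 5)) (shift t (+ 1)) ⟨
  P (t - + 4) + P (t - + 5)          ∎
  where
  shift : ∀ t k → t - (+ 5 - k) ≡ k + (t - + 5)
  shift = solve-∀

ψ^ : ℤ → ℤ[ψ]
ψ^ t = ⟨ P (t - + 5) , P (t - + 3) , P (t - + 4) ⟩

ψ^-suc : ∀ t → ψ^ (sucℤ t) ≡ ψ · ψ^ t
ψ^-suc t = begin
  ψ^ (sucℤ t)
    ≡⟨ ⟨⟩-cong (cong P (shift t (+ 4)))
               (trans (cong P (shift t (+ 2))) (P[t-2]≡P[t-4]+P[t-5] t))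
               (cong P (shift t (+ 3))) ⟩
  ⟨ P (t - + 4) , P (t - + 4) + P (t - + 5) , P (t - + 3) ⟩
    ≡⟨ ψ·-coordinates (ψ^ t) ⟨
  ψ · ψ^ t ∎
  where
  shift : ∀ t k → 1ℤ + t - (1ℤ + k) ≡ t - k
  shift = solve-∀

ψ^-pred : ∀ t → ψ^ (pred t) ≡ ψ⁻¹ · ψ^ t
ψ^-pred t = begin
  ψ^ (pred t)               ≡⟨ ψ⁻¹·ψ·x≡x (ψ^ (pred t)) ⟨
  ψ⁻¹ · (ψ · ψ^ (pred t))   ≡⟨ cong (ψ⁻¹ ·_) (ψ^-suc (pred t)) ⟨
  ψ⁻¹ · ψ^ (sucℤ (pred t))  ≡⟨ cong (λ u → ψ⁻¹ · ψ^ u) (suc-pred t) ⟩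
  ψ⁻¹ · ψ^ t                ∎

ψ^-+ : ∀ s t → ψ^ (s + t) ≡ ψ^ s · ψ^ t
ψ^-+ s = ℤ-induction (λ t → ψ^ (s + t) ≡ ψ^ s · ψ^ t)
  (trans (cong ψ^ (+-identityʳ s)) (sym (·-identityʳ (ψ^ s))))
  (step ψ ψ^-suc (x∙yz≈y∙xz s 1ℤ))
  (step ψ⁻¹ ψ^-pred (+-pred s))
  where
  step : ∀ {f : ℤ → ℤ} g → (∀ t → ψ^ (f t) ≡ g · ψ^ t) → (∀ t → s + f t ≡ f (s + t)) →
         ∀ t → ψ^ (s + t) ≡ ψ^ s · ψ^ t → ψ^ (s + f t) ≡ ψ^ s · ψ^ (f t)
  step {f} g ψ^-f +-f t ih = begin
    ψ^ (s + f t)       ≡⟨ cong ψ^ (+-f t) ⟩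
    ψ^ (f (s + t))     ≡⟨ ψ^-f (s + t) ⟩
    g · ψ^ (s + t)     ≡⟨ cong (g ·_) ih ⟩
    g · (ψ^ s · ψ^ t)  ≡⟨ x·yz≡y·xz g (ψ^ s) (ψ^ t) ⟩
    ψ^ s · (g · ψ^ t)  ≡⟨ cong (ψ^ s ·_) (ψ^-f t) ⟨
    ψ^ s · ψ^ (f t)    ∎

adj-ψ^ : ∀ t → adj (ψ^ t) ≡ ψ^ (- t)
adj-ψ^ = ℤ-induction (λ t → adj (ψ^ t) ≡ ψ^ (- t)) refl up down
  where
  up : ∀ t → adj (ψ^ t) ≡ ψ^ (- t) → adj (ψ^ (sucℤ t)) ≡ ψ^ (- sucℤ t)
  up t ih = begin
    adj (ψ^ (sucℤ t))  ≡⟨ cong adj (ψ^-suc t) ⟩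
    adj (ψ · ψ^ t)     ≡⟨ adj-ψ· (ψ^ t) ⟩
    ψ⁻¹ · adj (ψ^ t)   ≡⟨ cong (ψ⁻¹ ·_) ih ⟩
    ψ⁻¹ · ψ^ (- t)     ≡⟨ ψ^-pred (- t) ⟨
    ψ^ (pred (- t))    ≡⟨ cong ψ^ (neg-distrib-+ 1ℤ t) ⟨
    ψ^ (- sucℤ t)      ∎
  down : ∀ t → adj (ψ^ t) ≡ ψ^ (- t) → adj (ψ^ (pred t)) ≡ ψ^ (- pred t)
  down t ih = begin
    adj (ψ^ (pred t))  ≡⟨ cong adj (ψ^-pred t) ⟩
    adj (ψ⁻¹ · ψ^ t)   ≡⟨ adj-ψ⁻¹· (ψ^ t) ⟩
    ψ · adj (ψ^ t)     ≡⟨ cong (ψ ·_) ih ⟩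
    ψ · ψ^ (- t)       ≡⟨ ψ^-suc (- t) ⟨
    ψ^ (sucℤ (- t))    ≡⟨ cong ψ^ (neg-distrib-+ -1ℤ t) ⟨
    ψ^ (- pred t)      ∎

N-ψ^ : ∀ t → N (ψ^ t) ≡ 1ℤ
N-ψ^ t = begin
  c₀ (ψ^ t · adj (ψ^ t))  ≡⟨ cong (λ y → c₀ (ψ^ t · y)) (adj-ψ^ t) ⟩
  c₀ (ψ^ t · ψ^ (- t))    ≡⟨ cong c₀ (ψ^-+ t (- t)) ⟨
  c₀ (ψ^ (t - t))         ≡⟨ cong (c₀ ∘ ψ^) (+-inverseʳ t) ⟩
  1ℤ                      ∎

tr-ψ^ : ∀ t → tr (ψ^ t) ≡ ρ t
tr-ψ^ t = begin
  tr (ψ^ t)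
    ≡⟨ trace (P (t - + 4)) (P (t - + 5)) ⟩
  + 3 * (P (t - + 4) + P (t - + 5)) - P (t - + 4)
    ≡⟨ cong (λ x → + 3 * x - P (t - + 4)) (P[t-2]≡P[t-4]+P[t-5] t) ⟨
  ρ t ∎
  where
  trace : ∀ x y → y + y + y + x + x ≡ + 3 * (x + y) - x
  trace = solve-∀

c₁-ψ^ : ∀ t → c₁ (ψ^ (+ 3 + t)) ≡ P t
c₁-ψ^ t = cong P (3+t-3≡t t)
  where
  3+t-3≡t : ∀ t → + 3 + t - + 3 ≡ t
  3+t-3≡t = solve-∀

P-step-recurrence : ∀ a b →
  P (b + (a + (a + a))) ≡ ρ a * P (b + (a + a)) + σ a * P (b + a) + P b
P-step-recurrence a b = begin
  P (b + (a + (a + a)))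
    ≡⟨ c₁-w· (a + (a + a)) ⟨
  c₁ (w · ψ^ (a + (a + a)))
    ≡⟨ cong (λ z → c₁ (w · z)) (trans (ψ^-+ a (a + a)) (cong (y ·_) (ψ^-+ a a))) ⟩
  c₁ (w · y ³)
    ≡⟨ cayley-hamilton w y ⟩
  tr y * c₁ (w · y ²) - tr (adj y) * c₁ (w · y) + N y * c₁ w
    ≡⟨ cong₂ _+_ (cong₂ _-_ (cong₂ _*_ (tr-ψ^ a) c₁-w·y²) (cong₂ _*_ tr-adj-y (c₁-w· a)))
                 (cong₂ _*_ (N-ψ^ a) (c₁-ψ^ b)) ⟩
  ρ a * P (b + (a + a)) - ρ (- a) * P (b + a) + 1ℤ * P b
    ≡⟨ cong₂ _+_ (cong (_+_ (ρ a * P (b + (a + a)))) (neg-distribˡ-* (ρ (- a)) (P (b + a))))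
                 (*-identityˡ (P b)) ⟩
  ρ a * P (b + (a + a)) + σ a * P (b + a) + P b ∎
  where
  w = ψ^ (+ 3 + b)
  y = ψ^ a
  c₁-w· : ∀ s → c₁ (w · ψ^ s) ≡ P (b + s)
  c₁-w· s = begin
    c₁ (w · ψ^ s)            ≡⟨ cong c₁ (ψ^-+ (+ 3 + b) s) ⟨
    c₁ (ψ^ (+ 3 + b + s))    ≡⟨ cong (c₁ ∘ ψ^) (+-assoc (+ 3) b s) ⟩
    c₁ (ψ^ (+ 3 + (b + s)))  ≡⟨ c₁-ψ^ (b + s) ⟩
    P (b + s)                ∎
  c₁-w·y² : c₁ (w · y ²) ≡ P (b + (a + a))
  c₁-w·y² = trans (cong (λ z → c₁ (w · z)) (sym (ψ^-+ a a))) (c₁-w· (a + a))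
  tr-adj-y : tr (adj y) ≡ ρ (- a)
  tr-adj-y = trans (cong tr (adj-ψ^ a)) (tr-ψ^ (- a))

mainTheorem4 : ∀ (a n : ℤ) → a < n →
    P n ≡ ρ a * P (n - a) + σ a * P (n - + 2 * a) + P (n - + 3 * a)
mainTheorem4 a n _ = begin
  P n                                            ≡⟨ cong P (n≡b+3a n a) ⟩
  P (b + (a + (a + a)))                          ≡⟨ P-step-recurrence a b ⟩
  ρ a * P (b + (a + a)) + σ a * P (b + a) + P b  ≡⟨ cong₂ (λ i j → ρ a * P i + σ a * P j + P b)
                                                           (n-a≡b+2a n a) (n-2a≡b+a n a) ⟨
  ρ a * P (n - a) + σ a * P (n - + 2 * a) + P (n - + 3 * a) ∎
  where
  b = n - + 3 * a
  n≡b+3a : ∀ n a → n ≡ n - + 3 * a + (a + (a + a))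
  n≡b+3a = solve-∀
  n-a≡b+2a : ∀ n a → n - a ≡ n - + 3 * a + (a + a)
  n-a≡b+2a = solve-∀
  n-2a≡b+a : ∀ n a → n - + 2 * a ≡ n - + 3 * a + a
  n-2a≡b+a = solve-∀
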